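{- Let $m\ge 1$ and $k\ge1$ be integers and let $X,Y\subsetneq[m]$ satisfy $|X|+|Y|\le m-k$. Let $\tilde k>0$ with $\tilde k\le k\le m$, and let $p=\min\{150m/\tilde k^2,\,1\}$. Define the random set $S\subseteq[m]$ by including each element of $[m]$ independently with probability $p$. Then \[\Pr_S\big[\,|S\cap X|+|S\cap Y|\ge |S|\,\big]\le \tfrac12.\]
   Context: $[m]=\{1,\dots,m\}$.
   Formalization: The parameter k̃ ranges over the positive rationals. -}

module Defs where

open import Data.Nat as ℕ using (ℕ; zero; suc; _≤?_)
open import Data.Bool using (Bool; true; false)
open import Data.Vec using (Vec; []; _∷_)
open import Data.List using (List; []; _∷_; map; _++_; filter)
open import Data.Fin.Subset using (Subset; ∣_∣; _∩_)
open import Data.Rational as ℚ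
  using (ℚ; 0ℚ; 1ℚ; _+_; _*_; _-_; _⊓_; _<_; 1/_; positive)
open import Data.Rational.Properties using (pos⇒nonZero)
open import Data.Integer using (+_)
open import Relation.Nullary using (Dec)
open import Relation.Unary using (Decidable)

allSubsets : (n : ℕ) → List (Subset n)
allSubsets zero    = [] ∷ []
allSubsets (suc n) = map (true ∷_) (allSubsets n) ++ map (false ∷_) (allSubsets n)

-- Probability that the p-random subset (each element independently
-- included with probability p) equals the given subset S:
-- p^|S| (1-p)^(n-|S|).
weight : ℚ → {n : ℕ} → Subset n → ℚ
weight p []            = 1ℚ
weight p (true  ∷ s)   = p * weight p s
weight p (false ∷ s)   = (1ℚ - p) * weight p s

sumℚ : List ℚ → ℚ
sumℚ []       = 0ℚ
sumℚ (x ∷ xs) = x + sumℚ xs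

Pr : ℚ → (n : ℕ) → {E : Subset n → Set} → Decidable E → ℚ
Pr p n E? = sumℚ (map (weight p) (filter E? (allSubsets n)))

ℕtoℚ : ℕ → ℚ
ℕtoℚ n = (+ n) ℚ./ 1

pParam : (m : ℕ) (k̃ : ℚ) → 0ℚ < k̃ → ℚ
pParam m k̃ k̃>0 =
  (ℕtoℚ (150 ℕ.* m) * (1/ k̃) * (1/ k̃)) ⊓ 1ℚ
  where instance
    k̃≢0 : ℚ.NonZero k̃
    k̃≢0 = pos⇒nonZero k̃ {{positive k̃>0}}

Bad : {m : ℕ} → Subset m → Subset m → Subset m → Set
Bad X Y S = ∣ S ∣ ℕ.≤ ∣ S ∩ X ∣ ℕ.+ ∣ S ∩ Y ∣

bad? : {m : ℕ} (X Y : Subset m) → Decidable (Bad X Y)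
bad? X Y S = ∣ S ∣ ≤? ∣ S ∩ X ∣ ℕ.+ ∣ S ∩ Y ∣

-- Let d i = 1 - [i ∈ X] - [i ∈ Y] and Z S = Σ_{i ∈ S} d i. Since |S| = Z S + |S ∩ X| + |S ∩ Y|,
-- the event is Z S ≤ 0. Under the p-random S, Z has mean μ = p D where D = Σ d i =
-- m - |X| - |Y| ≥ k ≥ k̃, and variance p (1 - p) Σ d i² ≤ p (1 - p) m. Chebyshev gives
-- Pr[Z ≤ 0] ≤ Var Z / μ² ≤ (1 - p) m / (p k̃²), which is at most ½ for p = 150 m / k̃²,
-- and 0 for p = 1.
module Submission where

open import Defs
open import Data.Fin.Subset using (Subset; ⊤; _⊂_; ∣_∣; _∩_)

module _ where
  open import Data.Bool using (Bool; true; false)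
  open import Data.Fin.Subset.Properties using (∣⊤∣≡n; ∩-identityˡ)
  import Data.Integer as ℤ
  import Data.Integer.Properties as ℤ
  open import Data.List using ([]; _∷_; map; _++_; filter)
  import Data.List.Properties as List
  open import Data.Nat as ℕ using (ℕ; zero; suc)
  import Data.Nat.Properties as ℕ
  open import Data.Nat.Coprimality using (1-coprimeTo) renaming (sym to coprime-sym)
  open import Data.Rational
    using (ℚ; mkℚ; 0ℚ; 1ℚ; ½; _+_; _*_; _-_; -_; _≤_; _<_; _⊓_; 1/_; *≤*
          ; >-nonZero; positive; nonNegative; nonPositive)
  open import Data.Rational.Properties
  open import Data.Rational.Solver using (module +-*-Solver)
  open import Data.Sum using (inj₁; inj₂; [_,_]′)
  open import Data.Vec using (Vec; []; _∷_; zipWith)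
  open import Function using (_∘_)
  open import Relation.Nullary using (yes; no)
  open import Relation.Unary using (Decidable)
  open import Relation.Binary.PropositionalEquality
  open +-*-Solver

  ℕtoℚ≡mkℚ : ∀ n → ℕtoℚ n ≡ mkℚ (ℤ.+ n) 0 (coprime-sym (1-coprimeTo n))
  ℕtoℚ≡mkℚ n = ↥p/↧p≡p (mkℚ (ℤ.+ n) 0 (coprime-sym (1-coprimeTo n)))

  ℕtoℚ-+ : ∀ a b → ℕtoℚ (a ℕ.+ b) ≡ ℕtoℚ a + ℕtoℚ b
  ℕtoℚ-+ a b =
    trans (/-cong {p₂ = ℤ.+ a ℤ.* ℤ.1ℤ ℤ.+ ℤ.+ b ℤ.* ℤ.1ℤ} {q₂ = 1} numerator≡ refl)
          (cong₂ _+_ (sym (ℕtoℚ≡mkℚ a)) (sym (ℕtoℚ≡mkℚ b)))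
    where
    numerator≡ : ℤ.+ (a ℕ.+ b) ≡ ℤ.+ a ℤ.* ℤ.1ℤ ℤ.+ ℤ.+ b ℤ.* ℤ.1ℤ
    numerator≡ = trans (ℤ.pos-+ a b)
      (sym (cong₂ ℤ._+_ (ℤ.*-identityʳ (ℤ.+ a)) (ℤ.*-identityʳ (ℤ.+ b))))

  ℕtoℚ-* : ∀ a b → ℕtoℚ (a ℕ.* b) ≡ ℕtoℚ a * ℕtoℚ b
  ℕtoℚ-* a b =
    trans (/-cong {p₂ = ℤ.+ a ℤ.* ℤ.+ b} {q₂ = 1} (ℤ.pos-* a b) refl)
          (cong₂ _*_ (sym (ℕtoℚ≡mkℚ a)) (sym (ℕtoℚ≡mkℚ b)))

  ℕtoℚ-mono-≤ : ∀ {a b} → a ℕ.≤ b → ℕtoℚ a ≤ ℕtoℚ b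
  ℕtoℚ-mono-≤ {a} {b} a≤b = subst₂ _≤_ (sym (ℕtoℚ≡mkℚ a)) (sym (ℕtoℚ≡mkℚ b))
    (*≤* (ℤ.*-monoʳ-≤-nonNeg ℤ.1ℤ (ℤ.+≤+ a≤b)))

  square : ℚ → ℚ
  square p = p * p

  *-nonNeg : ∀ {p q} → 0ℚ ≤ p → 0ℚ ≤ q → 0ℚ ≤ p * q
  *-nonNeg {p} {q} 0≤p 0≤q =
    nonNegative⁻¹ _ {{nonNeg*nonNeg⇒nonNeg p {{nonNegative 0≤p}} q {{nonNegative 0≤q}}}}

  *-pos : ∀ {p q} → 0ℚ < p → 0ℚ < q → 0ℚ < p * q
  *-pos {p} {q} 0<p 0<q = positive⁻¹ _ {{pos*pos⇒pos p {{positive 0<p}} q {{positive 0<q}}}}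

  square-nonNeg : ∀ p → 0ℚ ≤ square p
  square-nonNeg p with ≤-total 0ℚ p
  ... | inj₁ 0≤p = *-nonNeg 0≤p 0≤p
  ... | inj₂ p≤0 =
    nonNegative⁻¹ _ {{nonPos*nonPos⇒nonPos p {{nonPositive p≤0}} p {{nonPositive p≤0}}}}

  square-mono-≤ : ∀ {p q} → 0ℚ ≤ p → p ≤ q → square p ≤ square q
  square-mono-≤ {p} {q} 0≤p p≤q = ≤-trans
    (*-monoˡ-≤-nonNeg p {{nonNegative 0≤p}} p≤q)
    (*-monoʳ-≤-nonNeg q {{nonNegative (≤-trans 0≤p p≤q)}} p≤q)

  p≤p+q : ∀ {p q} → 0ℚ ≤ q → p ≤ p + q
  p≤p+q {p} {q} 0≤q = subst (_≤ p + q) (+-identityʳ p) (+-monoʳ-≤ p 0≤q)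

  +-cancelʳ-≤ : ∀ {p q} r → p + r ≤ q + r → p ≤ q
  +-cancelʳ-≤ {p} {q} r p+r≤q+r = begin
    p           ≡⟨ solve 2 (λ p r → p := p :+ r :- r) refl p r ⟩
    p + r - r   ≤⟨ +-monoˡ-≤ (- r) p+r≤q+r ⟩
    q + r - r   ≡⟨ solve 2 (λ q r → q :+ r :- r := q) refl q r ⟩
    q           ∎
    where open ≤-Reasoning

  ⊓-pos : ∀ {p q} → 0ℚ < p → 0ℚ < q → 0ℚ < p ⊓ q
  ⊓-pos {p} {q} 0<p 0<q = [ (λ p⊓q≡p → subst (0ℚ <_) (sym p⊓q≡p) 0<p)
                          , (λ p⊓q≡q → subst (0ℚ <_) (sym p⊓q≡q) 0<q) ]′ (⊓-sel p q)

  1-p≤1 : ∀ {p} → 0ℚ ≤ p → 1ℚ - p ≤ 1ℚ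
  1-p≤1 0≤p = +-monoʳ-≤ 1ℚ (neg-antimono-≤ 0≤p)

  0≤1-p : ∀ {p} → p ≤ 1ℚ → 0ℚ ≤ 1ℚ - p
  0≤1-p {p} p≤1 = subst (_≤ 1ℚ - p) (+-inverseʳ p) (+-monoˡ-≤ (- p) p≤1)

  sumℚ-++ : ∀ xs ys → sumℚ (xs ++ ys) ≡ sumℚ xs + sumℚ ys
  sumℚ-++ []       ys = sym (+-identityˡ (sumℚ ys))
  sumℚ-++ (x ∷ xs) ys = trans (cong (x +_) (sumℚ-++ xs ys)) (sym (+-assoc x _ _))

  sumℚ-map-*ˡ : ∀ {A : Set} c (f : A → ℚ) xs →
                sumℚ (map (λ x → c * f x) xs) ≡ c * sumℚ (map f xs)
  sumℚ-map-*ˡ c f []       = sym (*-zeroʳ c)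
  sumℚ-map-*ˡ c f (x ∷ xs) =
    trans (cong (c * f x +_) (sumℚ-map-*ˡ c f xs)) (sym (*-distribˡ-+ c _ _))

  sum-filter-*-≤ : ∀ {A : Set} {P : A → Set} (P? : Decidable P) (w f : A → ℚ) {c} →
                   (∀ x → 0ℚ ≤ w x) → (∀ x → 0ℚ ≤ f x) → (∀ x → P x → c ≤ f x) →
                   ∀ xs → sumℚ (map w (filter P? xs)) * c ≤ sumℚ (map (λ x → w x * f x) xs)
  sum-filter-*-≤ P? w f {c} w≥0 f≥0 c≤f [] = ≤-reflexive (*-zeroˡ c)
  sum-filter-*-≤ P? w f {c} w≥0 f≥0 c≤f (x ∷ xs) with P? x
  ... | yes Px = begin
    (w x + sumℚ (map w (filter P? xs))) * c     ≡⟨ *-distribʳ-+ c (w x) _ ⟩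
    w x * c + sumℚ (map w (filter P? xs)) * c   ≤⟨ +-mono-≤ (*-monoˡ-≤-nonNeg (w x) {{nonNegative (w≥0 x)}} (c≤f x Px)) IH ⟩
    w x * f x + sumℚ (map (λ x → w x * f x) xs) ∎
    where
    open ≤-Reasoning
    IH = sum-filter-*-≤ P? w f w≥0 f≥0 c≤f xs
  ... | no _ = begin
    sumℚ (map w (filter P? xs)) * c                   ≤⟨ sum-filter-*-≤ P? w f w≥0 f≥0 c≤f xs ⟩
    sumℚ (map (λ x → w x * f x) xs)                   ≡⟨ +-identityˡ _ ⟨
    0ℚ + sumℚ (map (λ x → w x * f x) xs)              ≤⟨ +-monoˡ-≤ _ (*-nonNeg (w≥0 x) (f≥0 x)) ⟩
    w x * f x + sumℚ (map (λ x → w x * f x) xs)       ∎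
    where open ≤-Reasoning

  𝔼 : ℚ → (n : ℕ) → (Subset n → ℚ) → ℚ
  𝔼 p n f = sumℚ (map (λ S → weight p S * f S) (allSubsets n))

  𝔼-cong : ∀ p n {f g : Subset n → ℚ} → (∀ S → f S ≡ g S) → 𝔼 p n f ≡ 𝔼 p n g
  𝔼-cong p n f≗g = cong sumℚ (List.map-cong (λ S → cong (weight p S *_) (f≗g S)) (allSubsets n))

  𝔼-suc : ∀ p n (f : Subset (suc n) → ℚ) →
          𝔼 p (suc n) f ≡ p * 𝔼 p n (f ∘ (true ∷_)) + (1ℚ - p) * 𝔼 p n (f ∘ (false ∷_))
  𝔼-suc p n f = begin
    sumℚ (map h (map (true ∷_) L ++ map (false ∷_) L))
      ≡⟨ cong sumℚ (List.map-++ h (map (true ∷_) L) _) ⟩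
    sumℚ (map h (map (true ∷_) L) ++ map h (map (false ∷_) L))
      ≡⟨ sumℚ-++ (map h (map (true ∷_) L)) _ ⟩
    sumℚ (map h (map (true ∷_) L)) + sumℚ (map h (map (false ∷_) L))
      ≡⟨ cong₂ _+_ (branch true p (λ _ → refl)) (branch false (1ℚ - p) (λ _ → refl)) ⟩
    p * 𝔼 p n (f ∘ (true ∷_)) + (1ℚ - p) * 𝔼 p n (f ∘ (false ∷_)) ∎
    where
    open ≡-Reasoning
    L = allSubsets n
    h = λ S → weight p S * f S
    branch : ∀ b c → (∀ S → weight p (b ∷ S) ≡ c * weight p S) →
             sumℚ (map h (map (b ∷_) L)) ≡ c * 𝔼 p n (f ∘ (b ∷_))
    branch b c weight-∷ = begin
      sumℚ (map h (map (b ∷_) L))                          ≡⟨ cong sumℚ (List.map-∘ L) ⟨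
      sumℚ (map (h ∘ (b ∷_)) L)                            ≡⟨ cong sumℚ (List.map-cong factor L) ⟩
      sumℚ (map (λ S → c * (weight p S * f (b ∷ S))) L)    ≡⟨ sumℚ-map-*ˡ c _ L ⟩
      c * 𝔼 p n (f ∘ (b ∷_))                               ∎
      where
      factor : ∀ S → h (b ∷ S) ≡ c * (weight p S * f (b ∷ S))
      factor S = trans (cong (_* f (b ∷ S)) (weight-∷ S)) (*-assoc c _ _)

  weight-nonNeg : ∀ {p} → 0ℚ ≤ p → p ≤ 1ℚ → ∀ {n} (S : Subset n) → 0ℚ ≤ weight p S
  weight-nonNeg 0≤p p≤1 []          = nonNegative⁻¹ 1ℚ
  weight-nonNeg 0≤p p≤1 (true  ∷ S) = *-nonNeg 0≤p (weight-nonNeg 0≤p p≤1 S)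
  weight-nonNeg 0≤p p≤1 (false ∷ S) = *-nonNeg (0≤1-p p≤1) (weight-nonNeg 0≤p p≤1 S)

  Pr*c≤𝔼 : ∀ {p n c} {E : Subset n → Set} (E? : Decidable E) {f : Subset n → ℚ} →
           0ℚ ≤ p → p ≤ 1ℚ → (∀ S → 0ℚ ≤ f S) → (∀ S → E S → c ≤ f S) →
           Pr p n E? * c ≤ 𝔼 p n f
  Pr*c≤𝔼 {p} {n} E? {f} 0≤p p≤1 f≥0 c≤f =
    sum-filter-*-≤ E? (weight p) f (weight-nonNeg 0≤p p≤1) f≥0 c≤f (allSubsets n)

  sumOver : ∀ {n} → Subset n → Vec ℚ n → ℚ
  sumOver []          []       = 0ℚ
  sumOver (true  ∷ S) (d ∷ ds) = d + sumOver S ds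
  sumOver (false ∷ S) (_ ∷ ds) = sumOver S ds

  sumOfSquares : ∀ {n} → Vec ℚ n → ℚ
  sumOfSquares []       = 0ℚ
  sumOfSquares (d ∷ ds) = square d + sumOfSquares ds

  sumOfSquares-nonNeg : ∀ {n} (d : Vec ℚ n) → 0ℚ ≤ sumOfSquares d
  sumOfSquares-nonNeg []       = ≤-refl
  sumOfSquares-nonNeg (d ∷ ds) = +-mono-≤ (square-nonNeg d) (sumOfSquares-nonNeg ds)

  𝔼-square-sumOver : ∀ p n (d : Vec ℚ n) t →
    𝔼 p n (λ S → square (sumOver S d + t)) ≡ p * (1ℚ - p) * sumOfSquares d + square (p * sumOver ⊤ d + t)
  𝔼-square-sumOver p zero [] t =
    solve 2 (λ p t → con 1ℚ :* ((con 0ℚ :+ t) :* (con 0ℚ :+ t)) :+ con 0ℚ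
                  := p :* (con 1ℚ :- p) :* con 0ℚ :+ (p :* con 0ℚ :+ t) :* (p :* con 0ℚ :+ t)) refl p t
  𝔼-square-sumOver p (suc n) (d ∷ ds) t = begin
    𝔼 p (suc n) (λ S → square (sumOver S (d ∷ ds) + t))
      ≡⟨ 𝔼-suc p n _ ⟩
    p * 𝔼 p n (λ S → square (d + sumOver S ds + t)) + (1ℚ - p) * 𝔼 p n (λ S → square (sumOver S ds + t))
      ≡⟨ cong (λ e → p * e + (1ℚ - p) * 𝔼 p n (λ S → square (sumOver S ds + t))) (𝔼-cong p n shift) ⟩
    p * 𝔼 p n (λ S → square (sumOver S ds + (d + t))) + (1ℚ - p) * 𝔼 p n (λ S → square (sumOver S ds + t))
      ≡⟨ cong₂ (λ e e′ → p * e + (1ℚ - p) * e′) (𝔼-square-sumOver p n ds (d + t)) (𝔼-square-sumOver p n ds t) ⟩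
    p * (V + square (p * D + (d + t))) + (1ℚ - p) * (V + square (p * D + t))
      ≡⟨ solve 5 (λ p d Q D t →
           p :* (p :* (con 1ℚ :- p) :* Q :+ (p :* D :+ (d :+ t)) :* (p :* D :+ (d :+ t)))
             :+ (con 1ℚ :- p) :* (p :* (con 1ℚ :- p) :* Q :+ (p :* D :+ t) :* (p :* D :+ t))
           := p :* (con 1ℚ :- p) :* (d :* d :+ Q) :+ (p :* (d :+ D) :+ t) :* (p :* (d :+ D) :+ t))
           refl p d (sumOfSquares ds) D t ⟩
    p * (1ℚ - p) * sumOfSquares (d ∷ ds) + square (p * sumOver ⊤ (d ∷ ds) + t) ∎
    where
    open ≡-Reasoning
    D = sumOver ⊤ ds
    V = p * (1ℚ - p) * sumOfSquares ds
    shift : ∀ S → square (d + sumOver S ds + t) ≡ square (sumOver S ds + (d + t))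
    shift S = cong square (solve 3 (λ d z t → d :+ z :+ t := z :+ (d :+ t)) refl d (sumOver S ds) t)

  Pr*mean²≤variance : ∀ {p n} (d : Vec ℚ n) {E : Subset n → Set} (E? : Decidable E) →
                      0ℚ ≤ p → p ≤ 1ℚ → 0ℚ ≤ sumOver ⊤ d → (∀ S → E S → sumOver S d ≤ 0ℚ) →
                      Pr p n E? * square (p * sumOver ⊤ d) ≤ p * (1ℚ - p) * sumOfSquares d
  Pr*mean²≤variance {p} {n} d {E} E? 0≤p p≤1 0≤D E⇒≤0 = begin
    Pr p n E? * square μ                      ≤⟨ Pr*c≤𝔼 E? 0≤p p≤1 (square-nonNeg ∘ deviation) mean²≤ ⟩
    𝔼 p n (square ∘ deviation)                ≡⟨ 𝔼-square-sumOver p n d (- μ) ⟩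
    V + square (μ + - μ)                      ≡⟨ cong (λ x → V + square x) (+-inverseʳ μ) ⟩
    V + 0ℚ                                    ≡⟨ +-identityʳ V ⟩
    V                                         ∎
    where
    open ≤-Reasoning
    μ = p * sumOver ⊤ d
    V = p * (1ℚ - p) * sumOfSquares d
    deviation : Subset n → ℚ
    deviation S = sumOver S d - μ
    mean²≤ : ∀ S → E S → square μ ≤ square (deviation S)
    mean²≤ S ES =
      subst (square μ ≤_) (solve 2 (λ z μ → (μ :- z) :* (μ :- z) := (z :- μ) :* (z :- μ)) refl z μ)
            (square-mono-≤ (*-nonNeg 0≤p 0≤D) (p≤p+q (neg-antimono-≤ (E⇒≤0 S ES))))
      where z = sumOver S d

  -- Var Z / (𝔼 Z)² ≤ ½ with the denominator cleared, for Z S = sumOver S d,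
  -- Q = sumOfSquares d and D = sumOver ⊤ d.
  RelVariance≤½ : ℚ → ℚ → ℚ → Set
  RelVariance≤½ p Q D = (1ℚ - p) * Q ≤ ½ * (p * square D)

  relVariance≤½⇒Pr≤½ : ∀ {p n} (d : Vec ℚ n) {E : Subset n → Set} (E? : Decidable E) →
                       0ℚ < p → p ≤ 1ℚ → 0ℚ < sumOver ⊤ d →
                       RelVariance≤½ p (sumOfSquares d) (sumOver ⊤ d) →
                       (∀ S → E S → sumOver S d ≤ 0ℚ) → Pr p n E? ≤ ½
  relVariance≤½⇒Pr≤½ {p} {n} d E? 0<p p≤1 0<D relVar E⇒≤0 =
    *-cancelʳ-≤-pos (square μ) {{positive (*-pos 0<μ 0<μ)}} (begin
      Pr p n E? * square μ                    ≤⟨ Pr*mean²≤variance d E? (<⇒≤ 0<p) p≤1 (<⇒≤ 0<D) E⇒≤0 ⟩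
      p * (1ℚ - p) * Q                        ≡⟨ *-assoc p (1ℚ - p) Q ⟩
      p * ((1ℚ - p) * Q)                      ≤⟨ *-monoˡ-≤-nonNeg p {{nonNegative (<⇒≤ 0<p)}} relVar ⟩
      p * (½ * (p * square D))
        ≡⟨ solve 2 (λ p D → p :* (con ½ :* (p :* (D :* D))) := con ½ :* ((p :* D) :* (p :* D))) refl p D ⟩
      ½ * square μ                            ∎)
    where
    open ≤-Reasoning
    Q = sumOfSquares d
    D = sumOver ⊤ d
    μ = p * D
    0<μ = *-pos 0<p 0<D

  𝟙 : Bool → ℚ
  𝟙 true  = 1ℚ
  𝟙 false = 0ℚ

  ℕtoℚ-∣∷∣ : ∀ {n} b (T : Subset n) → ℕtoℚ ∣ b ∷ T ∣ ≡ 𝟙 b + ℕtoℚ ∣ T ∣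
  ℕtoℚ-∣∷∣ true  T = ℕtoℚ-+ 1 ∣ T ∣
  ℕtoℚ-∣∷∣ false T = sym (+-identityˡ (ℕtoℚ ∣ T ∣))

  excess : ∀ {n} → Subset n → Subset n → Vec ℚ n
  excess = zipWith (λ x y → 1ℚ - 𝟙 x - 𝟙 y)

  ℕtoℚ-∣∣-excess : ∀ {n} (S X Y : Subset n) →
    ℕtoℚ ∣ S ∣ ≡ sumOver S (excess X Y) + (ℕtoℚ ∣ S ∩ X ∣ + ℕtoℚ ∣ S ∩ Y ∣)
  ℕtoℚ-∣∣-excess []          []      []      = refl
  ℕtoℚ-∣∣-excess (false ∷ S) (_ ∷ X) (_ ∷ Y) = ℕtoℚ-∣∣-excess S X Y
  ℕtoℚ-∣∣-excess (true  ∷ S) (x ∷ X) (y ∷ Y) = begin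
    ℕtoℚ ∣ true ∷ S ∣
      ≡⟨ ℕtoℚ-∣∷∣ true S ⟩
    1ℚ + ℕtoℚ ∣ S ∣
      ≡⟨ cong (1ℚ +_) (ℕtoℚ-∣∣-excess S X Y) ⟩
    1ℚ + (z + (u + v))
      ≡⟨ solve 5 (λ a b z u v → con 1ℚ :+ (z :+ (u :+ v))
                               := con 1ℚ :- a :- b :+ z :+ ((a :+ u) :+ (b :+ v)))
                 refl (𝟙 x) (𝟙 y) z u v ⟩
    1ℚ - 𝟙 x - 𝟙 y + z + ((𝟙 x + u) + (𝟙 y + v))
      ≡⟨ cong₂ (λ u′ v′ → 1ℚ - 𝟙 x - 𝟙 y + z + (u′ + v′)) (ℕtoℚ-∣∷∣ x (S ∩ X)) (ℕtoℚ-∣∷∣ y (S ∩ Y)) ⟨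
    sumOver (true ∷ S) (excess (x ∷ X) (y ∷ Y)) + (ℕtoℚ ∣ x ∷ S ∩ X ∣ + ℕtoℚ ∣ y ∷ S ∩ Y ∣) ∎
    where
    open ≡-Reasoning
    z = sumOver S (excess X Y)
    u = ℕtoℚ ∣ S ∩ X ∣
    v = ℕtoℚ ∣ S ∩ Y ∣

  Bad⇒sumOver-excess≤0 : ∀ {n} (X Y S : Subset n) → Bad X Y S → sumOver S (excess X Y) ≤ 0ℚ
  Bad⇒sumOver-excess≤0 X Y S bad = +-cancelʳ-≤ (ℕtoℚ ∣ S ∩ X ∣ + ℕtoℚ ∣ S ∩ Y ∣) (begin
    sumOver S (excess X Y) + (ℕtoℚ ∣ S ∩ X ∣ + ℕtoℚ ∣ S ∩ Y ∣) ≡⟨ ℕtoℚ-∣∣-excess S X Y ⟨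
    ℕtoℚ ∣ S ∣                                                ≤⟨ ℕtoℚ-mono-≤ bad ⟩
    ℕtoℚ (∣ S ∩ X ∣ ℕ.+ ∣ S ∩ Y ∣)                             ≡⟨ ℕtoℚ-+ ∣ S ∩ X ∣ ∣ S ∩ Y ∣ ⟩
    ℕtoℚ ∣ S ∩ X ∣ + ℕtoℚ ∣ S ∩ Y ∣                            ≡⟨ +-identityˡ _ ⟨
    0ℚ + (ℕtoℚ ∣ S ∩ X ∣ + ℕtoℚ ∣ S ∩ Y ∣)                     ∎)
    where open ≤-Reasoning

  k≤sumOver-excess : ∀ {m k} (X Y : Subset m) → k ℕ.≤ m → ∣ X ∣ ℕ.+ ∣ Y ∣ ℕ.≤ m ℕ.∸ k →
                     ℕtoℚ k ≤ sumOver ⊤ (excess X Y)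
  k≤sumOver-excess {m} {k} X Y k≤m |X|+|Y|≤m∸k = +-cancelʳ-≤ (ℕtoℚ ∣ X ∣ + ℕtoℚ ∣ Y ∣) (begin
    ℕtoℚ k + (ℕtoℚ ∣ X ∣ + ℕtoℚ ∣ Y ∣)
      ≡⟨ cong (ℕtoℚ k +_) (ℕtoℚ-+ ∣ X ∣ ∣ Y ∣) ⟨
    ℕtoℚ k + ℕtoℚ (∣ X ∣ ℕ.+ ∣ Y ∣)
      ≡⟨ ℕtoℚ-+ k _ ⟨
    ℕtoℚ (k ℕ.+ (∣ X ∣ ℕ.+ ∣ Y ∣))
      ≤⟨ ℕtoℚ-mono-≤ (ℕ.≤-trans (ℕ.+-monoʳ-≤ k |X|+|Y|≤m∸k) (ℕ.≤-reflexive (ℕ.m+[n∸m]≡n k≤m))) ⟩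
    ℕtoℚ m
      ≡⟨ cong ℕtoℚ (∣⊤∣≡n m) ⟨
    ℕtoℚ ∣ ⊤ {m} ∣
      ≡⟨ ℕtoℚ-∣∣-excess ⊤ X Y ⟩
    sumOver ⊤ (excess X Y) + (ℕtoℚ ∣ ⊤ ∩ X ∣ + ℕtoℚ ∣ ⊤ ∩ Y ∣)
      ≡⟨ cong₂ (λ U V → sumOver ⊤ (excess X Y) + (ℕtoℚ ∣ U ∣ + ℕtoℚ ∣ V ∣))
               (∩-identityˡ X) (∩-identityˡ Y) ⟩
    sumOver ⊤ (excess X Y) + (ℕtoℚ ∣ X ∣ + ℕtoℚ ∣ Y ∣) ∎)
    where open ≤-Reasoning

  sumOfSquares-excess≤n : ∀ {n} (X Y : Subset n) → sumOfSquares (excess X Y) ≤ ℕtoℚ n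
  sumOfSquares-excess≤n []      []      = ≤-refl
  sumOfSquares-excess≤n {suc n} (x ∷ X) (y ∷ Y) =
    subst (sumOfSquares (excess (x ∷ X) (y ∷ Y)) ≤_) (sym (ℕtoℚ-+ 1 n))
      (+-mono-≤ (square≤1 x y) (sumOfSquares-excess≤n X Y))
    where
    square≤1 : ∀ x y → square (1ℚ - 𝟙 x - 𝟙 y) ≤ 1ℚ
    square≤1 true  true  = ≤-refl
    square≤1 true  false = nonNegative⁻¹ 1ℚ
    square≤1 false true  = nonNegative⁻¹ 1ℚ
    square≤1 false false = ≤-refl

  ⊓1-relVariance≤½ : ∀ {q Q D} → 0ℚ ≤ q → 0ℚ ≤ Q → Q ≤ ½ * (q * square D) →
                     RelVariance≤½ (q ⊓ 1ℚ) Q D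
  ⊓1-relVariance≤½ {q} {Q} {D} 0≤q 0≤Q Q≤ with ⊓-sel q 1ℚ
  ... | inj₁ q⊓1≡q = subst (λ p → RelVariance≤½ p Q D) (sym q⊓1≡q) (begin
    (1ℚ - q) * Q         ≤⟨ *-monoʳ-≤-nonNeg Q {{nonNegative 0≤Q}} (1-p≤1 0≤q) ⟩
    1ℚ * Q               ≡⟨ *-identityˡ Q ⟩
    Q                    ≤⟨ Q≤ ⟩
    ½ * (q * square D)   ∎)
    where open ≤-Reasoning
  ... | inj₂ q⊓1≡1 = subst (λ p → RelVariance≤½ p Q D) (sym q⊓1≡1) (begin
    (1ℚ - 1ℚ) * Q        ≡⟨ *-zeroˡ Q ⟩
    0ℚ                   ≤⟨ *-nonNeg (nonNegative⁻¹ ½) (*-nonNeg (nonNegative⁻¹ 1ℚ) (square-nonNeg D)) ⟩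
    ½ * (1ℚ * square D)  ∎)
    where open ≤-Reasoning

  -- pParam m k̃ k̃>0 unfolds to 150m/k̃² m k̃ k̃>0 ⊓ 1ℚ.
  150m/k̃² : ℕ → (k̃ : ℚ) → 0ℚ < k̃ → ℚ
  150m/k̃² m k̃ k̃>0 = ℕtoℚ (150 ℕ.* m) * 1/ k̃ * 1/ k̃
    where instance _ = >-nonZero k̃>0

  150m/k̃²-pos : ∀ {m} → 1 ℕ.≤ m → ∀ k̃ (k̃>0 : 0ℚ < k̃) → 0ℚ < 150m/k̃² m k̃ k̃>0
  150m/k̃²-pos {m} 1≤m k̃ k̃>0 = *-pos (*-pos 150m>0 1/k̃>0) 1/k̃>0
    where
    instance _ = >-nonZero k̃>0
    1/k̃>0 : 0ℚ < 1/ k̃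
    1/k̃>0 = positive⁻¹ _ {{1/pos⇒pos k̃ {{positive k̃>0}}}}
    150m>0 : 0ℚ < ℕtoℚ (150 ℕ.* m)
    150m>0 = <-≤-trans (positive⁻¹ 1ℚ) (ℕtoℚ-mono-≤ (ℕ.≤-trans 1≤m (ℕ.m≤n*m m 150)))

  150m/k̃²*k̃² : ∀ m k̃ (k̃>0 : 0ℚ < k̃) → 150m/k̃² m k̃ k̃>0 * square k̃ ≡ ℕtoℚ (150 ℕ.* m)
  150m/k̃²*k̃² m k̃ k̃>0 = begin
    N * 1/ k̃ * 1/ k̃ * (k̃ * k̃)
      ≡⟨ solve 3 (λ N i k → N :* i :* i :* (k :* k) := N :* (i :* k) :* (i :* k)) refl N (1/ k̃) k̃ ⟩
    N * (1/ k̃ * k̃) * (1/ k̃ * k̃)   ≡⟨ cong (λ one → N * one * one) (*-inverseˡ k̃) ⟩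
    N * 1ℚ * 1ℚ                    ≡⟨ trans (*-identityʳ (N * 1ℚ)) (*-identityʳ N) ⟩
    N                              ∎
    where
    open ≡-Reasoning
    instance _ = >-nonZero k̃>0
    N = ℕtoℚ (150 ℕ.* m)

  pParam-pos : ∀ {m} → 1 ℕ.≤ m → ∀ k̃ (k̃>0 : 0ℚ < k̃) → 0ℚ < pParam m k̃ k̃>0
  pParam-pos 1≤m k̃ k̃>0 = ⊓-pos (150m/k̃²-pos 1≤m k̃ k̃>0) (positive⁻¹ 1ℚ)

  pParam≤1 : ∀ m k̃ (k̃>0 : 0ℚ < k̃) → pParam m k̃ k̃>0 ≤ 1ℚ
  pParam≤1 m k̃ k̃>0 = p⊓q≤q (150m/k̃² m k̃ k̃>0) 1ℚ

  pParam-relVariance≤½ : ∀ {m} → 1 ℕ.≤ m → ∀ k̃ (k̃>0 : 0ℚ < k̃) {Q D} →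
                         0ℚ ≤ Q → Q ≤ ℕtoℚ m → k̃ ≤ D → RelVariance≤½ (pParam m k̃ k̃>0) Q D
  pParam-relVariance≤½ {m} 1≤m k̃ k̃>0 {Q} {D} 0≤Q Q≤m k̃≤D =
    ⊓1-relVariance≤½ {q} {D = D} 0≤q 0≤Q (begin
    Q                                   ≤⟨ Q≤m ⟩
    ℕtoℚ m                              ≤⟨ ℕtoℚ-mono-≤ (ℕ.m≤n*m m 75) ⟩
    ℕtoℚ (75 ℕ.* m)                     ≡⟨ ℕtoℚ-* 75 m ⟩
    ½ * ℕtoℚ 150 * ℕtoℚ m               ≡⟨ *-assoc ½ (ℕtoℚ 150) (ℕtoℚ m) ⟩
    ½ * (ℕtoℚ 150 * ℕtoℚ m)             ≡⟨ cong (½ *_) (ℕtoℚ-* 150 m) ⟨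
    ½ * ℕtoℚ (150 ℕ.* m)                ≡⟨ cong (½ *_) (150m/k̃²*k̃² m k̃ k̃>0) ⟨
    ½ * (q * square k̃)                  ≤⟨ *-monoˡ-≤-nonNeg ½ (*-monoˡ-≤-nonNeg q {{nonNegative 0≤q}} k̃²≤D²) ⟩
    ½ * (q * square D)                  ∎)
    where
    open ≤-Reasoning
    q = 150m/k̃² m k̃ k̃>0
    0≤q = <⇒≤ (150m/k̃²-pos 1≤m k̃ k̃>0)
    k̃²≤D² = square-mono-≤ (<⇒≤ k̃>0) k̃≤D

open import Data.Nat using (ℕ; _≤_; _∸_; _+_)
open import Data.Rational as ℚ using (ℚ; 0ℚ; _<_; ½)
open import Data.Rational.Properties using (≤-trans; <-≤-trans)

lemma4p7 : (m k : ℕ) → 1 ≤ m → 1 ≤ k → k ≤ m →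
    (X Y : Subset m) → X ⊂ ⊤ → Y ⊂ ⊤ → ∣ X ∣ + ∣ Y ∣ ≤ m ∸ k →
    (k̃ : ℚ) (k̃>0 : 0ℚ < k̃) → k̃ ℚ.≤ ℕtoℚ k →
    Pr (pParam m k̃ k̃>0) m (bad? X Y) ℚ.≤ ½
lemma4p7 m k 1≤m _ k≤m X Y _ _ |X|+|Y|≤m∸k k̃ k̃>0 k̃≤k =
  relVariance≤½⇒Pr≤½ (excess X Y) (bad? X Y)
    (pParam-pos 1≤m k̃ k̃>0) (pParam≤1 m k̃ k̃>0) (<-≤-trans k̃>0 k̃≤D)
    (pParam-relVariance≤½ 1≤m k̃ k̃>0
      (sumOfSquares-nonNeg (excess X Y)) (sumOfSquares-excess≤n X Y) k̃≤D)
    (Bad⇒sumOver-excess≤0 X Y)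
  where
  k̃≤D : k̃ ℚ.≤ sumOver ⊤ (excess X Y)
  k̃≤D = ≤-trans k̃≤k (k≤sumOver-excess X Y k≤m |X|+|Y|≤m∸k)
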